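{- Let $n>0$ and let $a_0,\dots,a_{n-1},b_0,\dots,b_{n-1}$ be $2n$ different atoms. Let $W_0,\dots,W_{n-1},Z_0,\dots,Z_{n-1}$ be structures such that for each $i\in\{0,\dots,n-1\}$, $W_i=[a_i,b_i]$ or $W_i=\langle a_i;b_i\rangle$, and for each $j\in\{0,\dots,n-1\}$, $Z_j=(b_j,a_{j+1})$ or $Z_j=\langle b_j;a_{j+1}\rangle$, with indices counted modulo $n$. Then there is no derivation in $\{\mathsf{s},\mathsf{q}\downarrow,\mathsf{q}\uparrow\}$ with premise $(W_0,W_1,\dots,W_{n-1})$ and conclusion $[Z_0,Z_1,\dots,Z_{n-1}]$.
   Context: Atoms: countably many atoms $a,b,\dots$, each atom $a$ having a dual atom $\bar a$ with $\bar{\bar a}=a$. Structures are generated by $S::= a\mid \circ \mid [S,\dots,S]\mid (S,\dots,S)\mid \langle S;\dots;S\rangle \mid ?S\mid !S\mid \bar S$ (par $[\,]$, tensor $(\,)$, seq $\langle\,\rangle$ with at least one argument; unit $\circ$ not an atom), identified modulo the least congruence $=$ making par, tensor, seq associative, par and tensor commutative (seq not), $\circ$ a unit for all three, $[R]=(R)=\langle R\rangle=R$, with $\bar\circ=\circ$, $\overline{[R_1,\dots,R_h]}=(\bar R_1,\dots,\bar R_h)$, $\overline{(R_1,\dots,R_h)}=[\bar R_1,\dots,\bar R_h]$, $\overline{\langle R_1;\dots;R_h\rangle}=\langle\bar R_1;\dots;\bar R_h\rangle$, $\overline{?R}=!\bar R$, $\overline{!R}=?\bar R$, $\bar{\bar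 R}=R$. A context $S\{\;\}$ is a structure with one hole not under negation; $S[R,T]$ abbreviates $S\{[R,T]\}$ etc. A derivation in a rule set is a finite vertical chain of rule instances (each conclusion equal modulo $=$ to the next premise), possibly a single structure; top = premise, bottom = conclusion. Rules (premise $\Rightarrow$ conclusion, any context $S$ and structures $R,T,U,V$): $\mathsf{s}$: $S([R,U],T)\Rightarrow S[(R,T),U]$; $\mathsf{q}\downarrow$: $S\langle[R,U];[T,V]\rangle\Rightarrow S[\langle R;T\rangle,\langle U;V\rangle]$; $\mathsf{q}\uparrow$: $S(\langle R;U\rangle,\langle T;V\rangle)\Rightarrow S\langle(R,T);(U,V)\rangle$. -}

module Defs where

open import Data.Nat using (ℕ; zero; suc)
open import Data.Nat.DivMod using (_mod_)
open import Data.Bool using (Bool; not)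
open import Data.Product using (_×_; _,_)
open import Data.Fin using (Fin; toℕ) renaming (zero to fz; suc to fs)

Atom : Set
Atom = ℕ × Bool

dual : Atom → Atom
dual (k , p) = k , not p

-- Structures (n-ary par/tensor/seq rendered by binary constructors;
-- n-ary forms are recovered via associativity and the unit).
data Str : Set where
  atom : Atom → Str
  unit : Str
  par  : Str → Str → Str     -- [R,T]
  ten  : Str → Str → Str     -- (R,T)
  seq  : Str → Str → Str     -- ⟨R;T⟩
  why  : Str → Str
  bang : Str → Str
  neg  : Str → Str

infix 4 _≈_

data _≈_ : Str → Str → Set where
  ≈-refl  : ∀ {R} → R ≈ R
  ≈-sym   : ∀ {R T} → R ≈ T → T ≈ R
  ≈-trans : ∀ {R T U} → R ≈ T → T ≈ U → R ≈ U
  par-cong  : ∀ {R R' T T'} → R ≈ R' → T ≈ T' → par R T ≈ par R' T'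
  ten-cong  : ∀ {R R' T T'} → R ≈ R' → T ≈ T' → ten R T ≈ ten R' T'
  seq-cong  : ∀ {R R' T T'} → R ≈ R' → T ≈ T' → seq R T ≈ seq R' T'
  why-cong  : ∀ {R R'} → R ≈ R' → why R ≈ why R'
  bang-cong : ∀ {R R'} → R ≈ R' → bang R ≈ bang R'
  neg-cong  : ∀ {R R'} → R ≈ R' → neg R ≈ neg R'
  par-assoc : ∀ {R T U} → par (par R T) U ≈ par R (par T U)
  ten-assoc : ∀ {R T U} → ten (ten R T) U ≈ ten R (ten T U)
  seq-assoc : ∀ {R T U} → seq (seq R T) U ≈ seq R (seq T U)
  par-comm : ∀ {R T} → par R T ≈ par T R
  ten-comm : ∀ {R T} → ten R T ≈ ten T R
  par-unit  : ∀ {R} → par unit R ≈ R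
  ten-unit  : ∀ {R} → ten unit R ≈ R
  seq-unitˡ : ∀ {R} → seq unit R ≈ R
  seq-unitʳ : ∀ {R} → seq R unit ≈ R
  neg-atom : ∀ {a} → neg (atom a) ≈ atom (dual a)
  neg-unit : neg unit ≈ unit
  neg-par  : ∀ {R T} → neg (par R T) ≈ ten (neg R) (neg T)
  neg-ten  : ∀ {R T} → neg (ten R T) ≈ par (neg R) (neg T)
  neg-seq  : ∀ {R T} → neg (seq R T) ≈ seq (neg R) (neg T)
  neg-why  : ∀ {R} → neg (why R) ≈ bang (neg R)
  neg-bang : ∀ {R} → neg (bang R) ≈ why (neg R)
  neg-neg  : ∀ {R} → neg (neg R) ≈ R

-- One rule instance of s, q↓, q↑ in a context S{ } (hole not under negation):
-- Step P C means P is the premise and C the conclusion.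
data Step : Str → Str → Set where
  s    : ∀ {R T U} → Step (ten (par R U) T) (par (ten R T) U)
  q↓   : ∀ {R T U V} → Step (seq (par R U) (par T V)) (par (seq R T) (seq U V))
  q↑   : ∀ {R T U V} → Step (ten (seq R U) (seq T V)) (seq (ten R T) (ten U V))
  parˡ : ∀ {A B T} → Step A B → Step (par A T) (par B T)
  parʳ : ∀ {A B T} → Step A B → Step (par T A) (par T B)
  tenˡ : ∀ {A B T} → Step A B → Step (ten A T) (ten B T)
  tenʳ : ∀ {A B T} → Step A B → Step (ten T A) (ten T B)
  seqˡ : ∀ {A B T} → Step A B → Step (seq A T) (seq B T)
  seqʳ : ∀ {A B T} → Step A B → Step (seq T A) (seq T B)
  whyᶜ  : ∀ {A B} → Step A B → Step (why A) (why B)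
  bangᶜ : ∀ {A B} → Step A B → Step (bang A) (bang B)

data Deriv : Str → Str → Set where
  done : ∀ {P C} → P ≈ C → Deriv P C
  step : ∀ {P P' Q C} → P ≈ P' → Step P' Q → Deriv Q C → Deriv P C

bigTen : (n : ℕ) → (Fin n → Str) → Str
bigTen zero    f = unit
bigTen (suc n) f = ten (f fz) (bigTen n (λ i → f (fs i)))

bigPar : (n : ℕ) → (Fin n → Str) → Str
bigPar zero    f = unit
bigPar (suc n) f = par (f fz) (bigPar n (λ i → f (fs i)))

next : ∀ {m} → Fin (suc m) → Fin (suc m)
next {m} j = suc (toℕ j) mod suc m

-- A derivation in {s, q↓, q↑} can only increase the value of a structure in any
-- ordered model of the three connectives (monotone monoids with a common unit
-- validating s, q↓ and q↑ as inequalities).  In the three-element chain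
-- lo < mid < hi with unit mid, where ⊗ is absorbed by lo, ⅋ by hi and ◁ keeps
-- its first non-unit argument, send every aᵢ to hi and everything else to lo.
-- Both [aᵢ,bᵢ] and ⟨aᵢ;bᵢ⟩ then take the value hi, while both (bⱼ,aⱼ₊₁) and
-- ⟨bⱼ;aⱼ₊₁⟩ take the value lo; so the premise is worth hi and the conclusion lo.
module Submission where

open import Defs
open import Data.Empty using (⊥-elim)
open import Data.Fin using (Fin) renaming (zero to fz; suc to fs)
open import Data.Fin.Properties using (any?)
open import Data.Nat using (ℕ; zero; suc)
import Data.Nat as ℕ
import Data.Nat.Properties as ℕ
import Data.Bool.Properties as Bool
open import Data.Product using (_×_; _,_; proj₁; proj₂; zip′; swap)
open import Data.Product.Properties using (≡-dec)
open import Data.Sum using (_⊎_; inj₁; inj₂)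
open import Function.Definitions using (Injective)
open import Algebra.Core using (Op₂)
import Algebra.Definitions
open import Relation.Binary.Core using (Rel; _Preserves₂_⟶_⟶_)
open import Relation.Binary.Definitions using (Reflexive; Transitive; Decidable; DecidableEquality)
open import Relation.Binary.PropositionalEquality
  using (_≡_; _≢_; refl; sym; trans; cong; cong₂; subst; subst₂)
open import Relation.Nullary using (¬_; Dec; yes; no)
open import Relation.Nullary.Decidable using (from-yes; map′; _×-dec_; _→-dec_)
open import Level using (0ℓ)

dual-involutive : ∀ x → dual (dual x) ≡ x
dual-involutive (k , p) = cong (k ,_) (Bool.not-involutive p)

record Model : Set₁ where
  infixr 7 _⊗_
  infixr 6 _⅋_
  infixr 5 _◁_
  infix 4 _≤_
  field
    Carrier : Set
    _≤_ : Rel Carrier 0ℓ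
    ≤-refl : Reflexive _≤_
    ≤-trans : Transitive _≤_
    ε : Carrier
    _⊗_ _⅋_ _◁_ : Op₂ Carrier

  open Algebra.Definitions {A = Carrier} _≡_

  field
    ⊗-assoc : Associative _⊗_
    ⊗-comm : Commutative _⊗_
    ⊗-identityˡ : LeftIdentity ε _⊗_
    ⅋-assoc : Associative _⅋_
    ⅋-comm : Commutative _⅋_
    ⅋-identityˡ : LeftIdentity ε _⅋_
    ◁-assoc : Associative _◁_
    ◁-identityˡ : LeftIdentity ε _◁_
    ◁-identityʳ : RightIdentity ε _◁_
    ⊗-mono : _⊗_ Preserves₂ _≤_ ⟶ _≤_ ⟶ _≤_
    ⅋-mono : _⅋_ Preserves₂ _≤_ ⟶ _≤_ ⟶ _≤_
    ◁-mono : _◁_ Preserves₂ _≤_ ⟶ _≤_ ⟶ _≤_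
    s-law : ∀ r t u → (r ⅋ u) ⊗ t ≤ (r ⊗ t) ⅋ u
    q↓-law : ∀ r t u v → (r ⅋ u) ◁ (t ⅋ v) ≤ (r ◁ t) ⅋ (u ◁ v)
    q↑-law : ∀ r t u v → (r ◁ u) ⊗ (t ◁ v) ≤ (r ⊗ t) ◁ (u ⊗ v)

  ⊗-identityʳ : RightIdentity ε _⊗_
  ⊗-identityʳ x = trans (⊗-comm x ε) (⊗-identityˡ x)

  ⅋-identityʳ : RightIdentity ε _⅋_
  ⅋-identityʳ x = trans (⅋-comm x ε) (⅋-identityˡ x)

module Semantics (M : Model) (v : Atom → Model.Carrier M) where
  open Model M

  -- A structure is interpreted together with its negation, so that negation
  -- is the swap of the two components and needs no counterpart in the model.
  ⟦_⟧ : Str → Carrier × Carrier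
  ⟦ atom x ⟧ = v x , v (dual x)
  ⟦ unit ⟧ = ε , ε
  ⟦ par R T ⟧ = zip′ _⅋_ _⊗_ ⟦ R ⟧ ⟦ T ⟧
  ⟦ ten R T ⟧ = zip′ _⊗_ _⅋_ ⟦ R ⟧ ⟦ T ⟧
  ⟦ seq R T ⟧ = zip′ _◁_ _◁_ ⟦ R ⟧ ⟦ T ⟧
  ⟦ why R ⟧ = ⟦ R ⟧
  ⟦ bang R ⟧ = ⟦ R ⟧
  ⟦ neg R ⟧ = swap ⟦ R ⟧

  ⟦_⟧⁺ : Str → Carrier
  ⟦ R ⟧⁺ = proj₁ ⟦ R ⟧

  ≈-sound : ∀ {R T} → R ≈ T → ⟦ R ⟧ ≡ ⟦ T ⟧
  ≈-sound ≈-refl = refl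
  ≈-sound (≈-sym e) = sym (≈-sound e)
  ≈-sound (≈-trans e f) = trans (≈-sound e) (≈-sound f)
  ≈-sound (par-cong e f) = cong₂ (zip′ _⅋_ _⊗_) (≈-sound e) (≈-sound f)
  ≈-sound (ten-cong e f) = cong₂ (zip′ _⊗_ _⅋_) (≈-sound e) (≈-sound f)
  ≈-sound (seq-cong e f) = cong₂ (zip′ _◁_ _◁_) (≈-sound e) (≈-sound f)
  ≈-sound (why-cong e) = ≈-sound e
  ≈-sound (bang-cong e) = ≈-sound e
  ≈-sound (neg-cong e) = cong swap (≈-sound e)
  ≈-sound (par-assoc {U = U}) =
    cong₂ _,_ (⅋-assoc _ _ (proj₁ ⟦ U ⟧)) (⊗-assoc _ _ (proj₂ ⟦ U ⟧))
  ≈-sound (ten-assoc {U = U}) =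
    cong₂ _,_ (⊗-assoc _ _ (proj₁ ⟦ U ⟧)) (⅋-assoc _ _ (proj₂ ⟦ U ⟧))
  ≈-sound (seq-assoc {U = U}) =
    cong₂ _,_ (◁-assoc _ _ (proj₁ ⟦ U ⟧)) (◁-assoc _ _ (proj₂ ⟦ U ⟧))
  ≈-sound (par-comm {R}) =
    cong₂ _,_ (⅋-comm (proj₁ ⟦ R ⟧) _) (⊗-comm (proj₂ ⟦ R ⟧) _)
  ≈-sound (ten-comm {R}) =
    cong₂ _,_ (⊗-comm (proj₁ ⟦ R ⟧) _) (⅋-comm (proj₂ ⟦ R ⟧) _)
  ≈-sound (par-unit {R}) = cong₂ _,_ (⅋-identityˡ _) (⊗-identityˡ (proj₂ ⟦ R ⟧))
  ≈-sound (ten-unit {R}) = cong₂ _,_ (⊗-identityˡ _) (⅋-identityˡ (proj₂ ⟦ R ⟧))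
  ≈-sound (seq-unitˡ {R}) = cong₂ _,_ (◁-identityˡ _) (◁-identityˡ (proj₂ ⟦ R ⟧))
  ≈-sound (seq-unitʳ {R}) = cong₂ _,_ (◁-identityʳ _) (◁-identityʳ (proj₂ ⟦ R ⟧))
  ≈-sound (neg-atom {x}) = cong (λ y → v (dual x) , v y) (sym (dual-involutive x))
  ≈-sound neg-unit = refl
  ≈-sound neg-par = refl
  ≈-sound neg-ten = refl
  ≈-sound neg-seq = refl
  ≈-sound neg-why = refl
  ≈-sound neg-bang = refl
  ≈-sound neg-neg = refl

  step-mono : ∀ {P C} → Step P C → ⟦ P ⟧⁺ ≤ ⟦ C ⟧⁺
  step-mono s = s-law _ _ _
  step-mono q↓ = q↓-law _ _ _ _
  step-mono q↑ = q↑-law _ _ _ _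
  step-mono (parˡ st) = ⅋-mono (step-mono st) ≤-refl
  step-mono (parʳ st) = ⅋-mono ≤-refl (step-mono st)
  step-mono (tenˡ st) = ⊗-mono (step-mono st) ≤-refl
  step-mono (tenʳ st) = ⊗-mono ≤-refl (step-mono st)
  step-mono (seqˡ st) = ◁-mono (step-mono st) ≤-refl
  step-mono (seqʳ st) = ◁-mono ≤-refl (step-mono st)
  step-mono (whyᶜ st) = step-mono st
  step-mono (bangᶜ st) = step-mono st

  ≈-sound⁺ : ∀ {R T} → R ≈ T → ⟦ R ⟧⁺ ≡ ⟦ T ⟧⁺
  ≈-sound⁺ e = cong proj₁ (≈-sound e)

  ≈⇒≤ : ∀ {R T} → R ≈ T → ⟦ R ⟧⁺ ≤ ⟦ T ⟧⁺
  ≈⇒≤ e = subst (_ ≤_) (≈-sound⁺ e) ≤-refl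

  deriv-mono : ∀ {P C} → Deriv P C → ⟦ P ⟧⁺ ≤ ⟦ C ⟧⁺
  deriv-mono (done e) = ≈⇒≤ e
  deriv-mono (step e st d) = ≤-trans (≈⇒≤ e) (≤-trans (step-mono st) (deriv-mono d))

  bigTen-idem : ∀ {x} n (f : Fin (suc n) → Str) → x ⊗ x ≡ x →
                (∀ i → ⟦ f i ⟧⁺ ≡ x) → ⟦ bigTen (suc n) f ⟧⁺ ≡ x
  bigTen-idem zero f _ fx = trans (⊗-identityʳ _) (fx fz)
  bigTen-idem (suc n) f idem fx =
    trans (cong₂ _⊗_ (fx fz) (bigTen-idem n (λ i → f (fs i)) idem (λ i → fx (fs i)))) idem

  bigPar-idem : ∀ {x} n (f : Fin (suc n) → Str) → x ⅋ x ≡ x →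
                (∀ i → ⟦ f i ⟧⁺ ≡ x) → ⟦ bigPar (suc n) f ⟧⁺ ≡ x
  bigPar-idem zero f _ fx = trans (⅋-identityʳ _) (fx fz)
  bigPar-idem (suc n) f idem fx =
    trans (cong₂ _⅋_ (fx fz) (bigPar-idem n (λ i → f (fs i)) idem (λ i → fx (fs i)))) idem

data Three : Set where
  lo mid hi : Three

module ThreeValued where
  rank : Three → ℕ
  rank lo = 0
  rank mid = 1
  rank hi = 2

  infixr 7 _⊗_
  infixr 6 _⅋_
  infixr 5 _◁_
  infix 4 _≤_ _≟_ _≤?_

  _≤_ : Rel Three 0ℓ
  x ≤ y = rank x ℕ.≤ rank y

  _⊗_ : Op₂ Three
  lo ⊗ _ = lo
  mid ⊗ y = y
  hi ⊗ lo = lo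
  hi ⊗ _ = hi

  _⅋_ : Op₂ Three
  hi ⅋ _ = hi
  mid ⅋ y = y
  lo ⅋ hi = hi
  lo ⅋ _ = lo

  _◁_ : Op₂ Three
  mid ◁ y = y
  x ◁ _ = x

  _≟_ : DecidableEquality Three
  lo ≟ lo = yes refl
  lo ≟ mid = no λ ()
  lo ≟ hi = no λ ()
  mid ≟ lo = no λ ()
  mid ≟ mid = yes refl
  mid ≟ hi = no λ ()
  hi ≟ lo = no λ ()
  hi ≟ mid = no λ ()
  hi ≟ hi = yes refl

  _≤?_ : Decidable _≤_
  x ≤? y = rank x ℕ.≤? rank y

  ∀? : {P : Three → Set} → (∀ x → Dec (P x)) → Dec (∀ x → P x)
  ∀? P? = map′ (λ (l , m , h) → λ { lo → l ; mid → m ; hi → h })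
               (λ p → p lo , p mid , p hi)
               (P? lo ×-dec P? mid ×-dec P? hi)

  monotone : ∀ {_∙_ : Op₂ Three} →
             (∀ x y u v → x ≤ y → u ≤ v → (x ∙ u) ≤ (y ∙ v)) → _∙_ Preserves₂ _≤_ ⟶ _≤_ ⟶ _≤_
  monotone mono = mono _ _ _ _

  model : Model
  model = record
    { Carrier = Three
    ; _≤_ = _≤_
    ; ≤-refl = ℕ.≤-refl
    ; ≤-trans = ℕ.≤-trans
    ; ε = mid
    ; _⊗_ = _⊗_
    ; _⅋_ = _⅋_
    ; _◁_ = _◁_
    ; ⊗-assoc = from-yes (∀? λ x → ∀? λ y → ∀? λ z → (x ⊗ y) ⊗ z ≟ x ⊗ (y ⊗ z))
    ; ⊗-comm = from-yes (∀? λ x → ∀? λ y → x ⊗ y ≟ y ⊗ x)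
    ; ⊗-identityˡ = λ _ → refl
    ; ⅋-assoc = from-yes (∀? λ x → ∀? λ y → ∀? λ z → (x ⅋ y) ⅋ z ≟ x ⅋ (y ⅋ z))
    ; ⅋-comm = from-yes (∀? λ x → ∀? λ y → x ⅋ y ≟ y ⅋ x)
    ; ⅋-identityˡ = λ _ → refl
    ; ◁-assoc = from-yes (∀? λ x → ∀? λ y → ∀? λ z → (x ◁ y) ◁ z ≟ x ◁ (y ◁ z))
    ; ◁-identityˡ = λ _ → refl
    ; ◁-identityʳ = from-yes (∀? λ x → x ◁ mid ≟ x)
    ; ⊗-mono = monotone (from-yes (∀? λ x → ∀? λ y → ∀? λ u → ∀? λ v →
                 x ≤? y →-dec u ≤? v →-dec x ⊗ u ≤? y ⊗ v))
    ; ⅋-mono = monotone (from-yes (∀? λ x → ∀? λ y → ∀? λ u → ∀? λ v →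
                 x ≤? y →-dec u ≤? v →-dec x ⅋ u ≤? y ⅋ v))
    ; ◁-mono = monotone (from-yes (∀? λ x → ∀? λ y → ∀? λ u → ∀? λ v →
                 x ≤? y →-dec u ≤? v →-dec x ◁ u ≤? y ◁ v))
    ; s-law = from-yes (∀? λ r → ∀? λ t → ∀? λ u → (r ⅋ u) ⊗ t ≤? (r ⊗ t) ⅋ u)
    ; q↓-law = from-yes (∀? λ r → ∀? λ t → ∀? λ u → ∀? λ v →
                  (r ⅋ u) ◁ (t ⅋ v) ≤? (r ◁ t) ⅋ (u ◁ v))
    ; q↑-law = from-yes (∀? λ r → ∀? λ t → ∀? λ u → ∀? λ v →
                  (r ◁ u) ⊗ (t ◁ v) ≤? (r ⊗ t) ◁ (u ⊗ v))
    }

_≟ₐ_ : DecidableEquality Atom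
_≟ₐ_ = ≡-dec ℕ._≟_ Bool._≟_

module _ {n} (a : Fin n → Atom) where
  image-indicator : Atom → Three
  image-indicator x with any? (λ i → a i ≟ₐ x)
  ... | yes _ = hi
  ... | no _ = lo

  image-indicator-∈ : ∀ i → image-indicator (a i) ≡ hi
  image-indicator-∈ i with any? (λ k → a k ≟ₐ a i)
  ... | yes _ = refl
  ... | no ∄k = ⊥-elim (∄k (i , refl))

  image-indicator-∉ : ∀ {x} → (∀ i → a i ≢ x) → image-indicator x ≡ lo
  image-indicator-∉ {x} a≢x with any? (λ k → a k ≟ₐ x)
  ... | yes (k , ak≡x) = ⊥-elim (a≢x k ak≡x)
  ... | no _ = refl

lemma5p20 : (m : ℕ) (a b : Fin (suc m) → Atom) →
    Injective _≡_ _≡_ a → Injective _≡_ _≡_ b → (∀ i j → a i ≢ b j) →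
    (W Z : Fin (suc m) → Str) →
    (∀ i → (W i ≈ par (atom (a i)) (atom (b i))) ⊎ (W i ≈ seq (atom (a i)) (atom (b i)))) →
    (∀ j → (Z j ≈ ten (atom (b j)) (atom (a (next j)))) ⊎ (Z j ≈ seq (atom (b j)) (atom (a (next j))))) →
    ¬ Deriv (bigTen (suc m) W) (bigPar (suc m) Z)
lemma5p20 m a b _ _ a≢b W Z W-shape Z-shape d =
  hi≰lo (subst₂ _≤_ (bigTen-idem m W refl W-hi) (bigPar-idem m Z refl Z-lo) (deriv-mono d))
  where
  open ThreeValued using (model; _≤_; _⊗_; _⅋_; _◁_)
  v : Atom → Three
  v = image-indicator a
  open Semantics model v

  v-a : ∀ i → v (a i) ≡ hi
  v-a = image-indicator-∈ a

  v-b : ∀ j → v (b j) ≡ lo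
  v-b j = image-indicator-∉ a (λ i → a≢b i j)

  W-hi : ∀ i → ⟦ W i ⟧⁺ ≡ hi
  W-hi i with W-shape i
  ... | inj₁ e = trans (≈-sound⁺ e) (cong (_⅋ v (b i)) (v-a i))
  ... | inj₂ e = trans (≈-sound⁺ e) (cong (_◁ v (b i)) (v-a i))

  Z-lo : ∀ j → ⟦ Z j ⟧⁺ ≡ lo
  Z-lo j with Z-shape j
  ... | inj₁ e = trans (≈-sound⁺ e) (cong (_⊗ v (a (next j))) (v-b j))
  ... | inj₂ e = trans (≈-sound⁺ e) (cong (_◁ v (a (next j))) (v-b j))

  hi≰lo : ¬ hi ≤ lo
  hi≰lo ()
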